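{- Let $n \geq 4$ be even. The honeycomb toroidal graph $\mathrm{HTG}(2,n,2)$ is 2-spanning cyclable if and only if $n=4$.
   Context: For integers $m\ge 1$, $\ell\ge 0$ and $n\ge 4$ with $n$ even and $m-\ell$ even, the honeycomb toroidal graph $\mathrm{HTG}(m,n,\ell)$ is the simple graph with vertex set $\{u_{i,j}: 0\le i\le m-1,\ 0\le j\le n-1\}$ (first subscript computed modulo $m$, second modulo $n$) whose edge set is the set of the following unordered pairs: $\{u_{i,j},u_{i,j+1}\}$ for all $i,j$ (vertical edges); $\{u_{i,j},u_{i+1,j}\}$ for all $0\le i\le m-2$ with $i+j$ odd (flat edges); and $\{u_{m-1,j},u_{0,j+\ell}\}$ for all $j$ having the same parity as $m$ (and $\ell$) (jump edges). (Repeated pairs give a single edge.) A 2-factor of a graph is a spanning subgraph in which every vertex has valency 2. A graph $X$ is 2-spanning cyclable if for every pair of distinct vertices $u,v$ of $X$ there is a 2-factor of $X$ consisting of exactly two cycles such that $u$ and $v$ lie in different cycles. -}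

module Defs where

open import Level using (0ℓ)
open import Data.Nat using (ℕ; zero; suc; _+_; _*_; _∸_)
open import Data.Nat.Divisibility using (_∣_)
open import Data.Fin using (Fin; toℕ)
open import Data.Product using (_×_; _,_; Σ; ∃; ∃₂)
open import Data.Sum using (_⊎_)
open import Relation.Nullary using (¬_)
open import Relation.Binary.PropositionalEquality using (_≡_; _≢_)
open import Relation.Binary.Construct.Closure.ReflexiveTransitive using (Star)

_≡[_]_ : ℕ → ℕ → ℕ → Set
a ≡[ n ] b = ∃₂ λ k l → a + k * n ≡ b + l * n

Odd : ℕ → Set
Odd x = ¬ (2 ∣ x)

Vtx : ℕ → ℕ → Set
Vtx m n = Fin m × Fin n

data Gen (m n ℓ : ℕ) : Vtx m n → Vtx m n → Set where
  vertical : ∀ {i j j'} → (toℕ j + 1) ≡[ n ] toℕ j' → Gen m n ℓ (i , j) (i , j')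
  flat : ∀ {i i' j} → toℕ i' ≡ suc (toℕ i) → Odd (toℕ i + toℕ j) →
         Gen m n ℓ (i , j) (i' , j)
  jump : ∀ {i i' j j'} → toℕ i ≡ m ∸ 1 → toℕ i' ≡ 0 → toℕ j ≡[ 2 ] m →
         (toℕ j + ℓ) ≡[ n ] toℕ j' → Gen m n ℓ (i , j) (i' , j')

HTG : (m n ℓ : ℕ) → Vtx m n → Vtx m n → Set
HTG m n ℓ u v = Gen m n ℓ u v ⊎ Gen m n ℓ v u

record TwoFactor (V : Set) (Adj : V → V → Set) : Set₁ where
  field
    F    : V → V → Set
    sub  : ∀ {x y} → F x y → Adj x y
    symm : ∀ {x y} → F x y → F y x
    deg2 : ∀ x → ∃₂ λ a b → a ≢ b × F x a × F x b ×
                   (∀ c → F x c → c ≡ a ⊎ c ≡ b)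

-- (V, Adj) is 2-spanning cyclable: for all distinct u, v there is a
-- 2-factor consisting of exactly two cycles (i.e. exactly two connected
-- components) with u and v in different cycles.
TwoSpanningCyclable : (V : Set) → (V → V → Set) → Set₁
TwoSpanningCyclable V Adj =
  ∀ (u v : V) → u ≢ v →
    Σ (TwoFactor V Adj) λ T →
      let open TwoFactor T in
      ¬ Star F u v × (∀ w → Star F u w ⊎ Star F v w)

{-# OPTIONS --safe #-}
-- HTG(2,n,2) is a necklace of n/2 blocks: block k consists of u_{0,2k+3}, u_{1,2k+2} on the left and
-- u_{0,2k+4}, u_{1,2k+3} on the right, every left vertex is adjacent to both right ones, and consecutive
-- blocks are joined by two junction edges. The graph is cubic, so a 2-factor omits exactly one edge at
-- each vertex, and a block passes on the number of junction edges used: none on the left forces none on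
-- the right, exactly one forces exactly one and connects the whole block. Take u = u_{0,3} and
-- v = u_{0,2}, which are joined by a junction edge. A 2-factor with two cycles separating them cannot use
-- that edge. If it uses the other edge of the same junction, then every block is traversed by one cycle
-- and u reaches v around the necklace; otherwise no junction edge is used, every block is a cycle of its
-- own, and for n ≥ 6 block 1 contains neither u nor v. For n = 4 the graph is the 3-cube: if u and v
-- differ in coordinate k, the two faces on which coordinate k is constant are the required 2-factor.
module Submission where

open import Defs
open import Data.Bool using (Bool; true; false)
open import Data.Bool.Properties using () renaming (_≟_ to _≟ᵇ_)
open import Data.Empty using (⊥-elim)
open import Data.Fin using (Fin; zero; suc; toℕ) renaming (_≟_ to _≟ᶠ_)
open import Data.Fin.Properties using (toℕ<n; toℕ-fromℕ<; fromℕ<-cong; fromℕ<-toℕ; any?; all?)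
open import Data.Nat using (ℕ; zero; suc; _+_; _*_; _∸_; _<_; _≤_; NonZero; s≤s; z<s; s<s)
  renaming (_≟_ to _≟ⁿ_)
open import Data.Nat.DivMod
  using (_%_; _/_; _mod_; m≡m%n+[m/n]*n; [m+kn]%n≡m%n; [m+n]%n≡m%n; m%n%n≡m%n; m<n⇒m%n≡m; m*n%n≡0)
open import Data.Nat.Divisibility
  using (_∣_; divides; _∣?_; ∣-refl; ∣-trans; n∣m*n; ∣m∣n⇒∣m+n; ∣m+n∣m⇒∣n; ∣1⇒≡1)
open import Data.Nat.Properties using (+-comm; +-cancelʳ-≡; +-commutativeSemigroup)
open import Algebra.Properties.CommutativeSemigroup +-commutativeSemigroup using (xy∙z≈xz∙y)
open import Data.Product using (_×_; _,_; ∃; ∃₂; proj₁; proj₂)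
open import Data.Product.Properties using (≡-dec)
import Data.Sum as Sum
open import Data.Sum using (_⊎_; inj₁; inj₂; [_,_]′; swap)
open import Data.Vec using (Vec; []; _∷_; lookup)
open import Function using (_∘_; _⇔_; mk⇔)
open import Level using (0ℓ)
open import Relation.Binary using (Setoid; Decidable; DecidableEquality)
open import Relation.Binary.PropositionalEquality
  using (_≡_; _≢_; refl; sym; trans; cong; subst; module ≡-Reasoning)
open import Relation.Binary.Construct.Closure.ReflexiveTransitive using (Star; ε; _◅_; _◅◅_)
open import Relation.Nullary using (¬_; Dec; ¬?)
import Relation.Binary.Reasoning.Setoid
import Relation.Nullary.Decidable as Dec
open import Relation.Nullary.Decidable using (map′; _×-dec_; _⊎-dec_; _→-dec_; from-yes)

module Modulo (N : ℕ) .{{_ : NonZero N}} where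

  ≡[]⇒%≡ : ∀ {a b} → a ≡[ N ] b → a % N ≡ b % N
  ≡[]⇒%≡ {a} {b} (k , l , eq) = begin
    a % N           ≡⟨ [m+kn]%n≡m%n a k N ⟨
    (a + k * N) % N ≡⟨ cong (_% N) eq ⟩
    (b + l * N) % N ≡⟨ [m+kn]%n≡m%n b l N ⟩
    b % N           ∎
    where open ≡-Reasoning

  %≡⇒≡[] : ∀ {a b} → a % N ≡ b % N → a ≡[ N ] b
  %≡⇒≡[] {a} {b} eq = b / N , a / N , (begin
    a + b / N * N                 ≡⟨ cong (_+ b / N * N) (m≡m%n+[m/n]*n a N) ⟩
    a % N + a / N * N + b / N * N ≡⟨ cong (λ r → r + a / N * N + b / N * N) eq ⟩
    b % N + a / N * N + b / N * N ≡⟨ xy∙z≈xz∙y (b % N) _ _ ⟩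
    b % N + b / N * N + a / N * N ≡⟨ cong (_+ a / N * N) (m≡m%n+[m/n]*n b N) ⟨
    b + a / N * N                 ∎)
    where open ≡-Reasoning

  _≡[N]?_ : Decidable _≡[ N ]_
  a ≡[N]? b = map′ %≡⇒≡[] ≡[]⇒%≡ (a % N ≟ⁿ b % N)

  ≡[]-setoid : Setoid 0ℓ 0ℓ
  ≡[]-setoid = record
    { _≈_           = _≡[ N ]_
    ; isEquivalence = record
      { refl  = 0 , 0 , refl
      ; sym   = λ (k , l , eq) → l , k , sym eq
      ; trans = λ p q → %≡⇒≡[] (trans (≡[]⇒%≡ p) (≡[]⇒%≡ q))
      }
    }

  open Setoid ≡[]-setoid public using () renaming (sym to ≡[]-sym)
  module ≡[]-Reasoning = Relation.Binary.Reasoning.Setoid ≡[]-setoid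

  ≡[]-+ʳ : ∀ {a b} c → a ≡[ N ] b → (a + c) ≡[ N ] (b + c)
  ≡[]-+ʳ {a} {b} c (k , l , eq) = k , l , (begin
    a + c + k * N ≡⟨ xy∙z≈xz∙y a c _ ⟩
    a + k * N + c ≡⟨ cong (_+ c) eq ⟩
    b + l * N + c ≡⟨ xy∙z≈xz∙y b _ c ⟩
    b + c + l * N ∎)
    where open ≡-Reasoning

  ≡[]-cancelʳ : ∀ {a b} c → (a + c) ≡[ N ] (b + c) → a ≡[ N ] b
  ≡[]-cancelʳ {a} {b} c (k , l , eq) = k , l , +-cancelʳ-≡ c _ _ (begin
    a + k * N + c ≡⟨ xy∙z≈xz∙y a _ c ⟩
    a + c + k * N ≡⟨ eq ⟩
    b + c + l * N ≡⟨ xy∙z≈xz∙y b c _ ⟩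
    b + l * N + c ∎)
    where open ≡-Reasoning

  ≡[]-even : 2 ∣ N → ∀ {a b} → a ≡[ N ] b → 2 ∣ a → 2 ∣ b
  ≡[]-even 2∣N {a} {b} (k , l , eq) 2∣a =
    ∣m+n∣m⇒∣n (subst (2 ∣_) (+-comm b (l * N)) 2∣b+lN) (∣-trans 2∣N (n∣m*n l))
    where
    2∣b+lN : 2 ∣ b + l * N
    2∣b+lN = subst (2 ∣_) eq (∣m∣n⇒∣m+n 2∣a (∣-trans 2∣N (n∣m*n k)))

  mod-≡[] : ∀ a → toℕ (a mod N) ≡[ N ] a
  mod-≡[] a = %≡⇒≡[] (trans (cong (_% N) (toℕ-fromℕ< _)) (m%n%n≡m%n a N))

  ≡[]⇒mod≡ : ∀ {a b} → a ≡[ N ] b → a mod N ≡ b mod N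
  ≡[]⇒mod≡ eq = fromℕ<-cong _ _ (≡[]⇒%≡ eq) _ _

  mod≡⇒≡[] : ∀ {a b} → a mod N ≡ b mod N → a ≡[ N ] b
  mod≡⇒≡[] eq = %≡⇒≡[] (trans (sym (toℕ-fromℕ< _)) (trans (cong toℕ eq) (toℕ-fromℕ< _)))

  mod-toℕ : ∀ (j : Fin N) → toℕ j mod N ≡ j
  mod-toℕ j = trans (fromℕ<-cong _ _ (m<n⇒m%n≡m (toℕ<n j)) _ _) (fromℕ<-toℕ j (toℕ<n j))

  toℕ-≡[] : ∀ {a} (j : Fin N) → toℕ j ≡[ N ] a → j ≡ a mod N
  toℕ-≡[] j eq = trans (sym (mod-toℕ j)) (≡[]⇒mod≡ eq)

  mod-after-step : ∀ a c (j : Fin N) → (toℕ (a mod N) + c) ≡[ N ] toℕ j → j ≡ (c + a) mod N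
  mod-after-step a c j step = toℕ-≡[] j (begin
    toℕ j             ≈⟨ step ⟨
    toℕ (a mod N) + c ≈⟨ ≡[]-+ʳ c (mod-≡[] a) ⟩
    a + c             ≡⟨ +-comm a c ⟩
    c + a             ∎)
    where open ≡[]-Reasoning

  mod-before-step : ∀ a c (j : Fin N) → (toℕ j + c) ≡[ N ] toℕ ((c + a) mod N) → j ≡ a mod N
  mod-before-step a c j step = toℕ-≡[] j (≡[]-cancelʳ c (begin
    toℕ j + c           ≈⟨ step ⟩
    toℕ ((c + a) mod N) ≈⟨ mod-≡[] (c + a) ⟩
    c + a               ≡⟨ +-comm c a ⟩
    a + c               ∎))
    where open ≡[]-Reasoning

  mod-shift-≡⇒≡0 : ∀ {k} a → k < N → (k + a) mod N ≡ a mod N → k ≡ 0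
  mod-shift-≡⇒≡0 {k} a k<N eq = begin
    k     ≡⟨ m<n⇒m%n≡m k<N ⟨
    k % N ≡⟨ ≡[]⇒%≡ (≡[]-cancelʳ {b = 0} a (mod≡⇒≡[] eq)) ⟩
    0 % N ≡⟨ m*n%n≡0 0 N ⟩
    0     ∎
    where open ≡-Reasoning

module _ (m n ℓ : ℕ) .{{_ : NonZero n}} where
  open Modulo n using (_≡[N]?_)
  open Modulo 2 using () renaming (_≡[N]?_ to _≡[2]?_)

  GenCases : Vtx m n → Vtx m n → Set
  GenCases (i , j) (i' , j') =
      i ≡ i' × (toℕ j + 1) ≡[ n ] toℕ j'
    ⊎ j ≡ j' × toℕ i' ≡ suc (toℕ i) × Odd (toℕ i + toℕ j)
    ⊎ toℕ i ≡ m ∸ 1 × toℕ i' ≡ 0 × toℕ j ≡[ 2 ] m × (toℕ j + ℓ) ≡[ n ] toℕ j'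

  GenCases⇔Gen : ∀ {u v} → GenCases u v ⇔ Gen m n ℓ u v
  GenCases⇔Gen = mk⇔ from to
    where
    from : ∀ {u v} → GenCases u v → Gen m n ℓ u v
    from {_ , _} {_ , _} (inj₁ (refl , step))                     = vertical step
    from {_ , _} {_ , _} (inj₂ (inj₁ (refl , below , odd)))       = flat below odd
    from {_ , _} {_ , _} (inj₂ (inj₂ (last , first , par , step))) = jump last first par step
    to : ∀ {u v} → Gen m n ℓ u v → GenCases u v
    to (vertical step)            = inj₁ (refl , step)
    to (flat below odd)           = inj₂ (inj₁ (refl , below , odd))
    to (jump last first par step) = inj₂ (inj₂ (last , first , par , step))

  Gen? : Decidable (Gen m n ℓ)
  Gen? (i , j) (i' , j') = Dec.map GenCases⇔Gen
    (      i ≟ᶠ i' ×-dec (toℕ j + 1) ≡[N]? toℕ j'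
     ⊎-dec j ≟ᶠ j' ×-dec toℕ i' ≟ⁿ suc (toℕ i) ×-dec ¬? (2 ∣? (toℕ i + toℕ j))
     ⊎-dec toℕ i ≟ⁿ m ∸ 1 ×-dec toℕ i' ≟ⁿ 0 ×-dec toℕ j ≡[2]? m ×-dec (toℕ j + ℓ) ≡[N]? toℕ j')

  HTG? : Decidable (HTG m n ℓ)
  HTG? u v = Gen? u v ⊎-dec Gen? v u

ExactlyOne : Set → Set → Set
ExactlyOne P Q = (P × ¬ Q) ⊎ (¬ P × Q)

record NeighboursAmong {V : Set} (Adj : V → V → Set) (x p q r : V) : Set where
  field
    neighbours : ∀ z → Adj x z → z ≡ p ⊎ z ≡ q ⊎ z ≡ r
    p≢q        : p ≢ q
    q≢r        : q ≢ r
    p≢r        : p ≢ r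

open NeighboursAmong

record Block {V : Set} (Adj : V → V → Set) : Set where
  field
    l₁ l₂ r₁ r₂ x₁ x₂ y₁ y₂ : V
    around-l₁ : NeighboursAmong Adj l₁ r₁ r₂ x₁
    around-l₂ : NeighboursAmong Adj l₂ r₁ r₂ x₂
    around-r₁ : NeighboursAmong Adj r₁ l₁ l₂ y₁
    around-r₂ : NeighboursAmong Adj r₂ l₁ l₂ y₂

  Contains : V → Set
  Contains z = z ≡ l₁ ⊎ z ≡ l₂ ⊎ z ≡ r₁ ⊎ z ≡ r₂

module TwoFactorProperties {V : Set} {Adj : V → V → Set} (T : TwoFactor V Adj) where
  open TwoFactor T

  data OneOmitted (x p q r : V) : Set where
    omit₁ : ¬ F x p → F x q → F x r → OneOmitted x p q r
    omit₂ : F x p → ¬ F x q → F x r → OneOmitted x p q r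
    omit₃ : F x p → F x q → ¬ F x r → OneOmitted x p q r

  non-neighbour : ∀ {x a b z} → (∀ c → F x c → c ≡ a ⊎ c ≡ b) → z ≢ a → z ≢ b → ¬ F x z
  non-neighbour only z≢a z≢b xz = [ z≢a , z≢b ]′ (only _ xz)

  one-omitted : ∀ {x p q r} → NeighboursAmong Adj x p q r → OneOmitted x p q r
  one-omitted {x} nb with deg2 x
  ... | a , b , a≢b , xa , xb , only with neighbours nb a (sub xa) | neighbours nb b (sub xb)
  ... | inj₁ refl        | inj₁ refl        = ⊥-elim (a≢b refl)
  ... | inj₁ refl        | inj₂ (inj₁ refl) = omit₃ xa xb (non-neighbour only (p≢r nb ∘ sym) (q≢r nb ∘ sym))
  ... | inj₁ refl        | inj₂ (inj₂ refl) = omit₂ xa (non-neighbour only (p≢q nb ∘ sym) (q≢r nb)) xb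
  ... | inj₂ (inj₁ refl) | inj₁ refl        = omit₃ xb xa (non-neighbour only (q≢r nb ∘ sym) (p≢r nb ∘ sym))
  ... | inj₂ (inj₁ refl) | inj₂ (inj₁ refl) = ⊥-elim (a≢b refl)
  ... | inj₂ (inj₁ refl) | inj₂ (inj₂ refl) = omit₁ (non-neighbour only (p≢q nb) (p≢r nb)) xa xb
  ... | inj₂ (inj₂ refl) | inj₁ refl        = omit₂ xb (non-neighbour only (q≢r nb) (p≢q nb ∘ sym)) xa
  ... | inj₂ (inj₂ refl) | inj₂ (inj₁ refl) = omit₁ (non-neighbour only (p≢r nb) (p≢q nb)) xb xa
  ... | inj₂ (inj₂ refl) | inj₂ (inj₂ refl) = ⊥-elim (a≢b refl)

  first-two-kept : ∀ {x p q r} → OneOmitted x p q r → ¬ F x r → F x p × F x q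
  first-two-kept (omit₁ _ _ xr)  ¬xr = ⊥-elim (¬xr xr)
  first-two-kept (omit₂ _ _ xr)  ¬xr = ⊥-elim (¬xr xr)
  first-two-kept (omit₃ xp xq _) _   = xp , xq

  third-kept : ∀ {x p q r} → OneOmitted x p q r → ¬ F x p ⊎ ¬ F x q → F x r
  third-kept (omit₁ _ _ xr) _          = xr
  third-kept (omit₂ _ _ xr) _          = xr
  third-kept (omit₃ xp _ _) (inj₁ ¬xp) = ⊥-elim (¬xp xp)
  third-kept (omit₃ _ xq _) (inj₂ ¬xq) = ⊥-elim (¬xq xq)

  third-omitted : ∀ {x p q r} → OneOmitted x p q r → F x p → F x q → ¬ F x r
  third-omitted (omit₁ ¬xp _ _) xp _  = ⊥-elim (¬xp xp)
  third-omitted (omit₂ _ ¬xq _) _  xq = ⊥-elim (¬xq xq)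
  third-omitted (omit₃ _ _ ¬xr) _  _  = ¬xr

  entered-from : ∀ {w z p q o} → NeighboursAmong Adj z p q o → ¬ F o z → F w z → w ≡ p ⊎ w ≡ q
  entered-from nb ¬oz wz with neighbours nb _ (sub (symm wz))
  ... | inj₁ w≡p         = inj₁ w≡p
  ... | inj₂ (inj₁ w≡q)  = inj₂ w≡q
  ... | inj₂ (inj₂ refl) = ⊥-elim (¬oz wz)

  -- Junction edges are oriented leftwards, F l₁ x₁ and F y₁ r₁, so that in a chain of blocks the
  -- right junction of one block is literally the left junction of the next.
  module _ (b : Block Adj) where
    open Block b

    no-crossing : ¬ F l₁ x₁ → ¬ F l₂ x₂ → ¬ F y₁ r₁ × ¬ F y₂ r₂
    no-crossing ¬l₁x₁ ¬l₂x₂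
      with first-two-kept (one-omitted around-l₁) ¬l₁x₁ | first-two-kept (one-omitted around-l₂) ¬l₂x₂
    ... | l₁r₁ , l₁r₂ | l₂r₁ , l₂r₂ =
      third-omitted (one-omitted around-r₁) (symm l₁r₁) (symm l₂r₁) ∘ symm ,
      third-omitted (one-omitted around-r₂) (symm l₁r₂) (symm l₂r₂) ∘ symm

    one-crossing : ExactlyOne (F l₁ x₁) (F l₂ x₂) →
                   ExactlyOne (F y₁ r₁) (F y₂ r₂) × Star F l₂ l₁ × Star F l₁ r₁ × Star F l₁ r₂
    one-crossing (inj₁ (l₁x₁ , ¬l₂x₂))
      with first-two-kept (one-omitted around-l₂) ¬l₂x₂ | one-omitted around-l₁
    ... | l₂r₁ , l₂r₂ | omit₁ ¬l₁r₁ l₁r₂ _ =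
      inj₁ (symm (third-kept (one-omitted around-r₁) (inj₁ (¬l₁r₁ ∘ symm))) ,
            third-omitted (one-omitted around-r₂) (symm l₁r₂) (symm l₂r₂) ∘ symm) ,
      l₂r₂ ◅ symm l₁r₂ ◅ ε , l₁r₂ ◅ symm l₂r₂ ◅ l₂r₁ ◅ ε , l₁r₂ ◅ ε
    ... | l₂r₁ , l₂r₂ | omit₂ l₁r₁ ¬l₁r₂ _ =
      inj₂ (third-omitted (one-omitted around-r₁) (symm l₁r₁) (symm l₂r₁) ∘ symm ,
            symm (third-kept (one-omitted around-r₂) (inj₁ (¬l₁r₂ ∘ symm)))) ,
      l₂r₁ ◅ symm l₁r₁ ◅ ε , l₁r₁ ◅ ε , l₁r₁ ◅ symm l₂r₁ ◅ l₂r₂ ◅ ε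
    ... | _ | omit₃ _ _ ¬l₁x₁ = ⊥-elim (¬l₁x₁ l₁x₁)
    one-crossing (inj₂ (¬l₁x₁ , l₂x₂))
      with first-two-kept (one-omitted around-l₁) ¬l₁x₁ | one-omitted around-l₂
    ... | l₁r₁ , l₁r₂ | omit₁ ¬l₂r₁ l₂r₂ _ =
      inj₁ (symm (third-kept (one-omitted around-r₁) (inj₂ (¬l₂r₁ ∘ symm))) ,
            third-omitted (one-omitted around-r₂) (symm l₁r₂) (symm l₂r₂) ∘ symm) ,
      l₂r₂ ◅ symm l₁r₂ ◅ ε , l₁r₁ ◅ ε , l₁r₂ ◅ ε
    ... | l₁r₁ , l₁r₂ | omit₂ l₂r₁ ¬l₂r₂ _ =
      inj₂ (third-omitted (one-omitted around-r₁) (symm l₁r₁) (symm l₂r₁) ∘ symm ,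
            symm (third-kept (one-omitted around-r₂) (inj₂ (¬l₂r₂ ∘ symm)))) ,
      l₂r₁ ◅ symm l₁r₁ ◅ ε , l₁r₁ ◅ ε , l₁r₂ ◅ ε
    ... | _ | omit₃ _ _ ¬l₂x₂ = ⊥-elim (¬l₂x₂ l₂x₂)

    closed : ¬ F l₁ x₁ → ¬ F l₂ x₂ → ¬ F y₁ r₁ → ¬ F y₂ r₂ →
             ∀ {w z} → Star F w z → Contains z → Contains w
    closed ¬l₁x₁ ¬l₂x₂ ¬y₁r₁ ¬y₂r₂ = backwards
      where
      back : ∀ {w z} → F w z → Contains z → Contains w
      back wz (inj₁ refl)               = inj₂ (inj₂ (entered-from around-l₁ (¬l₁x₁ ∘ symm) wz))
      back wz (inj₂ (inj₁ refl))        = inj₂ (inj₂ (entered-from around-l₂ (¬l₂x₂ ∘ symm) wz))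
      back wz (inj₂ (inj₂ (inj₁ refl))) = Sum.map₂ inj₁ (entered-from around-r₁ ¬y₁r₁ wz)
      back wz (inj₂ (inj₂ (inj₂ refl))) = Sum.map₂ inj₁ (entered-from around-r₂ ¬y₂r₂ wz)
      backwards : ∀ {w z} → Star F w z → Contains z → Contains w
      backwards ε           in-z = in-z
      backwards (wv ◅ path) in-z = back wv (backwards path in-z)

odd-suc : ∀ {a} → 2 ∣ a → Odd (suc a)
odd-suc {a} 2∣a 2∣1+a with ∣1⇒≡1 (∣m+n∣m⇒∣n (subst (2 ∣_) (+-comm 1 a) 2∣1+a) 2∣a)
... | ()

module HTG₂ (N : ℕ) .{{_ : NonZero N}} (2∣N : 2 ∣ N) where
  open Modulo N

  A B : ℕ → Vtx 2 N
  A j = zero , j mod N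
  B j = suc zero , j mod N

  A-distinct : ∀ k a → suc k < N → A (suc k + a) ≢ A a
  A-distinct _ a k<N eq with mod-shift-≡⇒≡0 a k<N (cong proj₂ eq)
  ... | ()

  B-distinct : ∀ k a → suc k < N → B (suc k + a) ≢ B a
  B-distinct _ a k<N eq with mod-shift-≡⇒≡0 a k<N (cong proj₂ eq)
  ... | ()

  A-periodic : ∀ a → A (a + N) ≡ A a
  A-periodic a = cong (zero ,_) (fromℕ<-cong _ _ ([m+n]%n≡m%n a N) _ _)

  even-mod : ∀ {a} → 2 ∣ toℕ (a mod N) → 2 ∣ a
  even-mod = ≡[]-even 2∣N (mod-≡[] _)

  mod-even : ∀ {a} → 2 ∣ a → 2 ∣ toℕ (a mod N)
  mod-even = ≡[]-even 2∣N (≡[]-sym (mod-≡[] _))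

  ≡[2]2⇒even : ∀ {a} → a ≡[ 2 ] 2 → 2 ∣ a
  ≡[2]2⇒even par = Modulo.≡[]-even 2 ∣-refl (Modulo.≡[]-sym 2 par) ∣-refl

  A-odd-neighbours : ∀ {j z} → Odd (suc j) → HTG 2 N 2 (A (suc j)) z →
                     z ≡ A (2 + j) ⊎ z ≡ B (suc j) ⊎ z ≡ A j
  A-odd-neighbours _   (inj₁ (vertical step)) = inj₁ (cong (zero ,_) (mod-after-step _ 1 _ step))
  A-odd-neighbours _   (inj₁ (flat {i' = suc zero} refl _)) = inj₂ (inj₁ refl)
  A-odd-neighbours _   (inj₁ (jump () _ _ _))
  A-odd-neighbours _   (inj₂ (vertical step)) = inj₂ (inj₂ (cong (zero ,_) (mod-before-step _ 1 _ step)))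
  A-odd-neighbours _   (inj₂ (flat () _))
  A-odd-neighbours odd (inj₂ (jump _ _ par step)) =
    ⊥-elim (odd (even-mod (≡[]-even 2∣N step (∣m∣n⇒∣m+n (≡[2]2⇒even par) ∣-refl))))

  A-even-neighbours : ∀ {j z} → 2 ∣ j → HTG 2 N 2 (A (2 + j)) z →
                      z ≡ A (suc j) ⊎ z ≡ B j ⊎ z ≡ A (3 + j)
  A-even-neighbours _   (inj₁ (vertical step)) = inj₂ (inj₂ (cong (zero ,_) (mod-after-step _ 1 _ step)))
  A-even-neighbours 2∣j (inj₁ (flat {i' = suc zero} refl odd)) = ⊥-elim (odd (mod-even (∣m∣n⇒∣m+n ∣-refl 2∣j)))
  A-even-neighbours _   (inj₁ (jump () _ _ _))
  A-even-neighbours _   (inj₂ (vertical step)) = inj₁ (cong (zero ,_) (mod-before-step _ 1 _ step))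
  A-even-neighbours _   (inj₂ (flat () _))
  A-even-neighbours _   (inj₂ (jump {i = suc zero} refl refl _ step)) =
    inj₂ (inj₁ (cong (suc zero ,_) (mod-before-step _ 2 _ step)))

  B-even-neighbours : ∀ {j z} → 2 ∣ suc j → HTG 2 N 2 (B (suc j)) z →
                      z ≡ A (3 + j) ⊎ z ≡ B (2 + j) ⊎ z ≡ B j
  B-even-neighbours _    (inj₁ (vertical step)) = inj₂ (inj₁ (cong (suc zero ,_) (mod-after-step _ 1 _ step)))
  B-even-neighbours _    (inj₁ (flat {i' = suc (suc ())} _ _))
  B-even-neighbours _    (inj₁ (jump {i' = zero} refl refl _ step)) = inj₁ (cong (zero ,_) (mod-after-step _ 2 _ step))
  B-even-neighbours _    (inj₂ (vertical step)) = inj₂ (inj₂ (cong (suc zero ,_) (mod-before-step _ 1 _ step)))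
  B-even-neighbours even (inj₂ (flat {i = zero} refl odd)) = ⊥-elim (odd (mod-even even))
  B-even-neighbours _    (inj₂ (jump _ () _ _))

  B-odd-neighbours : ∀ {j z} → Odd (suc j) → HTG 2 N 2 (B (suc j)) z →
                     z ≡ A (suc j) ⊎ z ≡ B j ⊎ z ≡ B (2 + j)
  B-odd-neighbours _   (inj₁ (vertical step)) = inj₂ (inj₂ (cong (suc zero ,_) (mod-after-step _ 1 _ step)))
  B-odd-neighbours _   (inj₁ (flat {i' = suc (suc ())} _ _))
  B-odd-neighbours odd (inj₁ (jump _ _ par _)) = ⊥-elim (odd (even-mod (≡[2]2⇒even par)))
  B-odd-neighbours _   (inj₂ (vertical step)) = inj₂ (inj₁ (cong (suc zero ,_) (mod-before-step _ 1 _ step)))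
  B-odd-neighbours _   (inj₂ (flat {i = zero} refl _)) = inj₁ refl
  B-odd-neighbours _   (inj₂ (jump _ () _ _))

module Necklace (h : ℕ) where
  N : ℕ
  N = 6 + h * 2

  open HTG₂ N (divides (3 + h) refl)
  open Block

  block : ℕ → Block (HTG 2 N 2)
  block k = record
    { l₁ = A (3 + d) ; l₂ = B (2 + d) ; r₁ = A (4 + d) ; r₂ = B (3 + d)
    ; x₁ = A (2 + d) ; x₂ = B (1 + d) ; y₁ = A (5 + d) ; y₂ = B (4 + d)
    ; around-l₁ = record { neighbours = λ _ → A-odd-neighbours {2 + d} odd
                         ; p≢q = λ () ; q≢r = λ () ; p≢r = A-distinct 1 (2 + d) 2<N }
    ; around-l₂ = record { neighbours = λ _ → B-even-neighbours {1 + d} even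
                         ; p≢q = λ () ; q≢r = B-distinct 1 (1 + d) 2<N ; p≢r = λ () }
    ; around-r₁ = record { neighbours = λ _ → A-even-neighbours {2 + d} even
                         ; p≢q = λ () ; q≢r = λ () ; p≢r = A-distinct 1 (3 + d) 2<N ∘ sym }
    ; around-r₂ = record { neighbours = λ _ → B-odd-neighbours {2 + d} odd
                         ; p≢q = λ () ; q≢r = B-distinct 1 (2 + d) 2<N ∘ sym ; p≢r = λ () }
    }
    where
    d : ℕ
    d = k * 2
    even : 2 ∣ 2 + d
    even = divides (suc k) refl
    odd : Odd (3 + d)
    odd = odd-suc even
    2<N : 2 < N
    2<N = s<s (s<s z<s)

  module _ (T : TwoFactor (Vtx 2 N) (HTG 2 N 2)) (separated : ¬ Star (TwoFactor.F T) (A 3) (A 2)) where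
    open TwoFactor T
    open TwoFactorProperties T

    ¬A₃A₂ : ¬ F (A 3) (A 2)
    ¬A₃A₂ A₃A₂ = separated (A₃A₂ ◅ ε)

    one-crossing-everywhere : ExactlyOne (F (A 3) (A 2)) (F (B 2) (B 1)) → ∀ k →
      ExactlyOne (F (l₁ (block k)) (x₁ (block k))) (F (l₂ (block k)) (x₂ (block k))) ×
      Star F (A 3) (l₁ (block k))
    one-crossing-everywhere c zero = c , ε
    one-crossing-everywhere c (suc k) with one-crossing-everywhere c k
    ... | ck , reached with one-crossing (block k) ck
    ... | ck' , _ , l₁⇝r₁ , l₁⇝r₂ = ck' , enter ck'
      where
      enter : ExactlyOne (F (y₁ (block k)) (r₁ (block k))) (F (y₂ (block k)) (r₂ (block k))) →
              Star F (A 3) (l₁ (block (suc k)))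
      enter (inj₁ (y₁r₁ , _)) = reached ◅◅ l₁⇝r₁ ◅◅ symm y₁r₁ ◅ ε
      enter (inj₂ (_ , y₂r₂)) =
        reached ◅◅ l₁⇝r₂ ◅◅ symm y₂r₂ ◅ proj₁ (proj₂ (one-crossing (block (suc k)) ck'))

    -- Block 2 + h is the last one: its r₁ is A (2 + N).
    ¬B₂B₁ : ¬ F (B 2) (B 1)
    ¬B₂B₁ B₂B₁ with one-crossing-everywhere (inj₂ (¬A₃A₂ , B₂B₁)) (2 + h)
    ... | c , reached = separated (subst (Star F (A 3)) (A-periodic 2)
                          (reached ◅◅ proj₁ (proj₂ (proj₂ (one-crossing (block (2 + h)) c)))))

    block₁-isolated : ∀ {w} → Star F w (A 5) → Contains (block 1) w
    block₁-isolated path with no-crossing (block 0) ¬A₃A₂ ¬B₂B₁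
    ... | ¬A₅A₄ , ¬B₄B₃ with no-crossing (block 1) ¬A₅A₄ ¬B₄B₃
    ... | ¬A₇A₆ , ¬B₆B₅ = closed (block 1) ¬A₅A₄ ¬B₄B₃ ¬A₇A₆ ¬B₆B₅ path (inj₁ refl)

    A₃∉block₁ : ¬ Contains (block 1) (A 3)
    A₃∉block₁ (inj₁ eq)               = A-distinct 1 3 (s<s (s<s z<s)) (sym eq)
    A₃∉block₁ (inj₂ (inj₂ (inj₁ eq))) = A-distinct 2 3 (s<s (s<s (s<s z<s))) (sym eq)

    A₂∉block₁ : ¬ Contains (block 1) (A 2)
    A₂∉block₁ (inj₁ eq)               = A-distinct 2 2 (s<s (s<s (s<s z<s))) (sym eq)
    A₂∉block₁ (inj₂ (inj₂ (inj₁ eq))) = A-distinct 3 2 (s<s (s<s (s<s (s<s z<s)))) (sym eq)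

    not-covered : ¬ (∀ w → Star F (A 3) w ⊎ Star F (A 2) w)
    not-covered covered =
      [ A₃∉block₁ ∘ block₁-isolated , A₂∉block₁ ∘ block₁-isolated ]′ (covered (A 5))

  not-two-spanning-cyclable : ¬ TwoSpanningCyclable (Vtx 2 N) (HTG 2 N 2)
  not-two-spanning-cyclable tsc with tsc (A 3) (A 2) (A-distinct 0 2 (s<s z<s))
  ... | T , separated , covered = not-covered T separated covered

module Cube where
  V₄ : Set
  V₄ = Vtx 2 4

  -- HTG(2,4,2) is the 3-cube in these coordinates, so Face k below consists of the two opposite faces
  -- on which coordinate k is constant.
  coordinates : V₄ → Vec Bool 3
  coordinates (i , j) = lookup (lookup rows i) j
    where
    rows : Vec (Vec (Vec Bool 3) 4) 2
    rows = ( (true  ∷ false ∷ false ∷ [])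
           ∷ (false ∷ false ∷ false ∷ [])
           ∷ (false ∷ false ∷ true  ∷ [])
           ∷ (true  ∷ false ∷ true  ∷ [])
           ∷ [])
         ∷ ( (false ∷ true  ∷ true  ∷ [])
           ∷ (false ∷ true  ∷ false ∷ [])
           ∷ (true  ∷ true  ∷ false ∷ [])
           ∷ (true  ∷ true  ∷ true  ∷ [])
           ∷ [])
         ∷ []

  side : Fin 3 → V₄ → Bool
  side k x = lookup (coordinates x) k

  Face : Fin 3 → V₄ → V₄ → Set
  Face k x y = HTG 2 4 2 x y × side k x ≡ side k y

  _≟ᵛ_ : DecidableEquality V₄
  _≟ᵛ_ = ≡-dec _≟ᶠ_ _≟ᶠ_

  ∀? : {P : V₄ → Set} → (∀ x → Dec (P x)) → Dec (∀ x → P x)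
  ∀? P? = map′ (λ h (i , j) → h i j) (λ h i j → h (i , j)) (all? λ i → all? λ j → P? (i , j))

  ∃? : {P : V₄ → Set} → (∀ x → Dec (P x)) → Dec (∃ P)
  ∃? P? = map′ (λ (i , j , p) → (i , j) , p) (λ ((i , j) , p) → i , j , p)
               (any? λ i → any? λ j → P? (i , j))

  Face? : ∀ k x y → Dec (Face k x y)
  Face? k x y = HTG? 2 4 2 x y ×-dec side k x ≟ᵇ side k y

  face-valency-2 : ∀ k x → ∃₂ λ a b → a ≢ b × Face k x a × Face k x b × (∀ c → Face k x c → c ≡ a ⊎ c ≡ b)
  face-valency-2 = from-yes (all? λ k → ∀? λ x → ∃? λ a → ∃? λ b →
    ¬? (a ≟ᵛ b) ×-dec Face? k x a ×-dec Face? k x b ×-dec ∀? λ c → Face? k x c →-dec (c ≟ᵛ a ⊎-dec c ≟ᵛ b))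

  coordinates-separate : ∀ u v → u ≢ v → ∃ λ k → side k u ≢ side k v
  coordinates-separate = from-yes (∀? λ u → ∀? λ v → ¬? (u ≟ᵛ v) →-dec any? λ k → ¬? (side k u ≟ᵇ side k v))

  face-diameter-2 : ∀ k u w → side k u ≡ side k w → ∃ λ a → (u ≡ a ⊎ Face k u a) × (a ≡ w ⊎ Face k a w)
  face-diameter-2 = from-yes (all? λ k → ∀? λ u → ∀? λ w → side k u ≟ᵇ side k w →-dec
    ∃? λ a → (u ≟ᵛ a ⊎-dec Face? k u a) ×-dec (a ≟ᵛ w ⊎-dec Face? k a w))

  face : Fin 3 → TwoFactor V₄ (HTG 2 4 2)
  face k = record
    { F    = Face k
    ; sub  = proj₁
    ; symm = λ (e , s) → swap e , sym s
    ; deg2 = face-valency-2 k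
    }

  side-invariant : ∀ {k u w} → Star (Face k) u w → side k u ≡ side k w
  side-invariant ε                = refl
  side-invariant ((_ , s) ◅ path) = trans s (side-invariant path)

  within-2 : ∀ {k u w} → ∃ (λ a → (u ≡ a ⊎ Face k u a) × (a ≡ w ⊎ Face k a w)) → Star (Face k) u w
  within-2 {k} (_ , first , second) = at-most-one first ◅◅ at-most-one second
    where
    at-most-one : ∀ {x y} → x ≡ y ⊎ Face k x y → Star (Face k) x y
    at-most-one (inj₁ refl) = ε
    at-most-one (inj₂ e)    = e ◅ ε

  bool-dichotomy : ∀ {a b : Bool} c → a ≢ b → a ≡ c ⊎ b ≡ c
  bool-dichotomy {false} {false} _     a≢b = ⊥-elim (a≢b refl)
  bool-dichotomy {true}  {true}  _     a≢b = ⊥-elim (a≢b refl)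
  bool-dichotomy {false} {true}  false _   = inj₁ refl
  bool-dichotomy {false} {true}  true  _   = inj₂ refl
  bool-dichotomy {true}  {false} false _   = inj₂ refl
  bool-dichotomy {true}  {false} true  _   = inj₁ refl

  two-spanning-cyclable : TwoSpanningCyclable V₄ (HTG 2 4 2)
  two-spanning-cyclable u v u≢v with coordinates-separate u v u≢v
  ... | k , differ = face k , differ ∘ side-invariant , reach
    where
    reach : ∀ w → Star (Face k) u w ⊎ Star (Face k) v w
    reach w = Sum.map (within-2 ∘ face-diameter-2 k u w) (within-2 ∘ face-diameter-2 k v w)
                      (bool-dichotomy (side k w) differ)

lemma3p2 : (n : ℕ) → 4 ≤ n → 2 ∣ n →
           (TwoSpanningCyclable (Vtx 2 n) (HTG 2 n 2) ⇔ n ≡ 4)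
lemma3p2 _ ()             (divides 0 refl)
lemma3p2 _ (s≤s (s≤s ())) (divides 1 refl)
lemma3p2 _ _              (divides 2 refl) = mk⇔ (λ _ → refl) (λ _ → Cube.two-spanning-cyclable)
lemma3p2 _ _              (divides (suc (suc (suc h))) refl) =
  mk⇔ (⊥-elim ∘ Necklace.not-two-spanning-cyclable h) (λ ())
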